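{- Let $\mathcal{G}$ be a cofinitary group, $r\in 2^\omega$ and $(s,E)\in\mathbb{Z}_\mathcal{G}(r)$. Then: (1) if $n\notin\mathrm{dom}(s)$, then for all but finitely many $m<\omega$ we have $(s\cup\{(n,m)\},E)\in\mathbb{Z}_\mathcal{G}(r)$ and $(s\cup\{(n,m)\},E)\le(s,E)$; (2) if $m\notin\mathrm{ran}(s)$, then for all but finitely many $n<\omega$ we have $(s\cup\{(n,m)\},E)\in\mathbb{Z}_\mathcal{G}(r)$ and $(s\cup\{(n,m)\},E)\le(s,E)$.
   Context: A cofinitary group is a subgroup $\mathcal{G}$ of the group $S_\infty$ of permutations of $\omega$ in which every non-identity element has only finitely many fixed points. Words: $W_\mathcal{G}$ is the set of words in the alphabet $\mathcal{G}\cup\{x,x^{ -1}\}$ with $x$ a new symbol. For a (partial) injection $s$ on $\omega$ and $w\in W_\mathcal{G}$, $w[s]$ is the partial injection obtained by replacing $x,x^{ -1}$ by $s,s^{ -1}$ and composing (rightmost letter applied first), and $\mathrm{fix}(w[s])=\{n: w[s](n)\text{ defined and }=n\}$. A word is nice if it is $x^k$ for some $k>0$ or of the form $g_lx^{k_l}\cdots g_1x^{k_1}g_0x^{k_0}$ with $k_0>0$, $k_1,\dots,k_l\in\mathbb{Z}\setminus\{0\}$, $g_0,\dots,g_l\in\mathcal{G}\setminus\{\mathrm{id}\}$; $W^*_\mathcal{G}$ is the set of nice words. Zhang's forcing $\mathbb{Z}_\mathcal{G}$ consists of pairs $(s,E)$ where $s$ is a finite partial injection from $\omega$ to $\omega$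 and $E$ is a finite subset of $W^*_\mathcal{G}$, ordered by $(t,F)\le(s,E)$ iff $s\subseteq t$, $E\subseteq F$ and $\mathrm{fix}(w[t])=\mathrm{fix}(w[s])$ for all $w\in E$. Orbits: for a finite partial injection $s$ and $n<\omega$, $O_s(n)$ is the smallest set containing $n$ closed under applying $s$ and $s^{ -1}$ (where defined); $\mathcal{O}_s=\{O_s(n):n<\omega\}$. An orbit $O\in\mathcal{O}_s$ is closed if $O\subseteq\mathrm{dom}(s)\cap\mathrm{ran}(s)$; $\mathcal{O}^c_s$ is the set of closed orbits. $s$ is nice if every $O\in\mathcal{O}^c_s$ satisfies $\min(O)<\min(\omega\setminus\bigcup\mathcal{O}^c_s)$. For nice $s$, order $\mathcal{O}^c_s$ by $O<P$ iff $\min O<\min P$, and let $o_s(n)=|O_n| \bmod 2$ for $n<|\mathcal{O}^c_s|$, where $O_n$ is the $n$-th element of $\mathcal{O}^c_s$ in this order. For $r\in 2^\omega$, a nice $s$ codes $r$ if $o_s\subseteq r$. $\mathbb{Z}_\mathcal{G}(r)$ is the set of $(s,E)\in\mathbb{Z}_\mathcal{G}$ such that $s$ is nice and codes $r$, with the order of $\mathbb{Z}_\mathcal{G}$. -}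

module Defs where

open import Data.Nat using (ℕ; zero; suc; _<_; _≤_; _%_)
open import Data.Integer as ℤ using (ℤ; +_; -[1+_])
open import Data.Fin using (Fin; toℕ)
open import Data.List using (List; []; _∷_; _++_; replicate; concat; reverse; map; length)
open import Data.List.Membership.Propositional using (_∈_)
open import Data.List.Relation.Unary.All using (All)
open import Data.List.Relation.Unary.Unique.Propositional using (Unique)
open import Data.Product using (Σ; ∃; _×_; _,_)
open import Data.Sum using (_⊎_)
open import Relation.Nullary using (¬_)
open import Relation.Binary.PropositionalEquality using (_≡_; _≢_)

record Perm : Set where
  field
    fun    : ℕ → ℕ
    inv    : ℕ → ℕ
    inv∘fun : ∀ n → inv (fun n) ≡ n
    fun∘inv : ∀ n → fun (inv n) ≡ n
open Perm public

IsIdentity : Perm → Set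
IsIdentity p = ∀ n → fun p n ≡ n

-- a subgroup of S_∞, given as a predicate on permutations
-- (closed under extensional equality, so that it is a genuine set of permutations)
record IsSubgroup (G : Perm → Set) : Set where
  field
    respects : ∀ p q → G p → (∀ n → fun p n ≡ fun q n) → G q
    hasId    : ∃ λ e → G e × IsIdentity e
    closed∘  : ∀ p q → G p → G q → ∃ λ c → G c × (∀ n → fun c n ≡ fun p (fun q n))
    closed⁻¹ : ∀ p → G p → ∃ λ c → G c × (∀ n → fun c n ≡ inv p n)

record IsCofinitary (G : Perm → Set) : Set where
  field
    subgroup   : IsSubgroup G
    cofinitary : ∀ p → G p → ¬ IsIdentity p → ∃ λ B → ∀ n → fun p n ≡ n → n < B

-- Finite partial injections, given as finite lists of pairs (as sets)

PInj : Set
PInj = List (ℕ × ℕ)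

IsPartialInjection : PInj → Set
IsPartialInjection s = ∀ a b a' b' → (a , b) ∈ s → (a' , b') ∈ s →
  (a ≡ a' → b ≡ b') × (b ≡ b' → a ≡ a')

Dom : PInj → ℕ → Set
Dom s n = ∃ λ m → (n , m) ∈ s

Ran : PInj → ℕ → Set
Ran s m = ∃ λ n → (n , m) ∈ s

-- Words in the alphabet G ∪ {x, x⁻¹}; the head of the list is the leftmost letter

data Letter : Set where
  gL  : Perm → Letter
  xL  : Letter
  xiL : Letter

Word : Set
Word = List Letter

LetterRel : Letter → PInj → ℕ → ℕ → Set
LetterRel (gL g) s k m = fun g k ≡ m
LetterRel xL     s k m = (k , m) ∈ s
LetterRel xiL    s k m = (m , k) ∈ s

-- Eval w s n m  :  w[s](n) is defined and equals m (rightmost letter applied first)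
Eval : Word → PInj → ℕ → ℕ → Set
Eval []      s n m = n ≡ m
Eval (l ∷ w) s n m = ∃ λ k → Eval w s n k × LetterRel l s k m

Fix : Word → PInj → ℕ → Set
Fix w s n = Eval w s n n

xpow : ℕ → Word
xpow k = replicate k xL

xint : ℤ → Word
xint (+ k)      = replicate k xL
xint -[1+ k ]   = replicate (suc k) xiL

-- g_l x^{k_l} ⋯ g_1 x^{k_1} g_0 x^{k_0}, where bs = [(k_1,g_1), …, (k_l,g_l)]
render : ℕ → Perm → List (ℤ × Perm) → Word
render k0 g0 bs = concat (reverse (map (λ { (k , g) → gL g ∷ xint k }) bs)) ++ (gL g0 ∷ xpow k0)

NonIdIn : (Perm → Set) → Perm → Set
NonIdIn G g = G g × ¬ IsIdentity g

IsNice : (Perm → Set) → Word → Set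
IsNice G w =
  (∃ λ k → 0 < k × w ≡ xpow k)
  ⊎ (Σ ℕ λ k0 → Σ Perm λ g0 → Σ (List (ℤ × Perm)) λ bs →
       0 < k0 × NonIdIn G g0
       × All (λ { (k , g) → k ≢ + 0 × NonIdIn G g }) bs
       × w ≡ render k0 g0 bs)

record IsCondition (G : Perm → Set) (s : PInj) (E : List Word) : Set where
  field
    pinj : IsPartialInjection s
    nice : All (IsNice G) E

LeqZ : PInj → List Word → PInj → List Word → Set
LeqZ t F s E =
  (∀ p → p ∈ s → p ∈ t)
  × (∀ w → w ∈ E → w ∈ F)
  × (∀ w → w ∈ E → ∀ n → (Fix w t n → Fix w s n) × (Fix w s n → Fix w t n))

data Reach (s : PInj) (a : ℕ) : ℕ → Set where
  here : Reach s a a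
  fwd  : ∀ {b c} → Reach s a b → (b , c) ∈ s → Reach s a c
  bwd  : ∀ {b c} → Reach s a b → (c , b) ∈ s → Reach s a c

ClosedOrb : PInj → ℕ → Set
ClosedOrb s a = ∀ k → Reach s a k → Dom s k × Ran s k

IsMinOf : (ℕ → Set) → ℕ → Set
IsMinOf P m = P m × (∀ k → P k → m ≤ k)

Card : (ℕ → Set) → ℕ → Set
Card P c = Σ (List ℕ) λ l → Unique l × (∀ x → (x ∈ l → P x) × (P x → x ∈ l)) × length l ≡ c

IsNicePInj : PInj → Set
IsNicePInj s = ∀ a μ ν → ClosedOrb s a → IsMinOf (Reach s a) μ →
  IsMinOf (λ k → ¬ ClosedOrb s k) ν → μ < ν

-- s codes r (s assumed nice): if O is a closed orbit with minimum μ, the index of O in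
-- the ordering of closed orbits by minima is the number i of closed orbits whose
-- minimum is < μ, and o_s(i) = |O| mod 2 must equal r(i).
Codes : PInj → (ℕ → Fin 2) → Set
Codes s r = ∀ a μ i c → ClosedOrb s a → IsMinOf (Reach s a) μ →
  Card (λ b → ClosedOrb s b × IsMinOf (Reach s b) b × b < μ) i →
  Card (Reach s a) c →
  toℕ (r i) ≡ c % 2

InZr : (Perm → Set) → (ℕ → Fin 2) → PInj → List Word → Set
InZr G r s E = IsCondition G s E × IsNicePInj s × Codes s r

{-# OPTIONS --safe #-}
module Submission where

-- Let t be s extended by (n , m), and let y be the new point (m in part (1), n in part (2)).
-- Since G is cofinitary, for all but finitely many y the points y, g y and g⁻¹ y, for the
-- finitely many letters g of words in E, are untouched by s and distinct from the other
-- endpoint, and g y ≢ y. Then y lies in dom t or in ran t but not both, so no closed orbit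
-- of t meets the new pair and the closed orbits, hence niceness and coding, are unchanged.
-- A new fixed point of w[t] must use the new pair; rotating w yields a cyclically reduced
-- word mapping y to itself, which is impossible.

open import Defs
open import Data.Nat using (ℕ; zero; suc; _≤_; _⊔_; z≤n)
open import Data.Nat.Properties using (m⊔n≤o⇒m≤o; m⊔n≤o⇒n≤o; <⇒≢; <⇒≱; ≤∧≢⇒<)
open import Data.Fin using (Fin)
open import Data.Integer using (ℤ; +_; -[1+_])
open import Data.List using (List; []; _∷_; _++_; _∷ʳ_; [_]; replicate; concat; reverse; map; initLast; _∷ʳ′_)
open import Data.List.Properties using (++-assoc; ++-identityʳ)
open import Data.List.Membership.Propositional using (_∈_)
open import Data.List.Relation.Unary.All as All using (All; []; _∷_)
open import Data.List.Relation.Unary.All.Properties using (++⁺; ++⁻; ∷ʳ⁻; concat⁺; map⁺; replicate⁺)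
open import Data.List.Relation.Unary.Any using (here; there)
open import Data.List.Relation.Unary.Linked using (Linked; []; [-]; _∷_)
open import Data.List.Relation.Binary.Permutation.Propositional using (↭-sym)
open import Data.List.Relation.Binary.Permutation.Propositional.Properties using (All-resp-↭; ↭-reverse)
open import Data.Product using (Σ; ∃; ∃₂; _×_; _,_; proj₁; proj₂)
open import Data.Sum as Sum using (_⊎_; inj₁; inj₂)
open import Data.Empty using (⊥; ⊥-elim)
open import Data.Unit using (⊤; tt)
open import Function using (_∘_)
open import Relation.Nullary using (¬_)
open import Relation.Binary.PropositionalEquality using (_≡_; _≢_; refl; sym; trans; cong; subst; ≢-sym)

private
  variable
    P Q : ℕ → Set
    G : Perm → Set
    s : PInj
    a b c k y z : ℕ
    l p : Letter
    w : Word

Eventually : (ℕ → Set) → Set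
Eventually P = ∃ λ B → ∀ y → B ≤ y → P y

eventually-map : (∀ {y} → P y → Q y) → Eventually P → Eventually Q
eventually-map f (B , p) = B , λ y B≤y → f (p y B≤y)

eventually-× : Eventually P → Eventually Q → Eventually (λ y → P y × Q y)
eventually-× (B , p) (C , q) = B ⊔ C , λ y h → p y (m⊔n≤o⇒m≤o B C h) , q y (m⊔n≤o⇒n≤o B C h)

eventually-All : ∀ {A : Set} {R : A → ℕ → Set} {xs : List A} →
  All (λ x → Eventually (R x)) xs → Eventually (λ y → All (λ x → R x y) xs)
eventually-All [] = 0 , λ _ _ → []
eventually-All (p ∷ ps) = eventually-map (λ (q , qs) → q ∷ qs) (eventually-× p (eventually-All ps))

eventually-≢ : ∀ c → Eventually (_≢ c)
eventually-≢ c = suc c , λ y c<y → ≢-sym (<⇒≢ c<y)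

eventually-≤∘ : (f h : ℕ → ℕ) → (∀ y → h (f y) ≡ y) → ∀ B → Eventually (λ y → B ≤ f y)
eventually-≤∘ f h h∘f zero = 0 , λ _ _ → z≤n
eventually-≤∘ f h h∘f (suc B) =
  eventually-map (λ (B≤fy , fy≢B) → ≤∧≢⇒< B≤fy (≢-sym fy≢B))
    (eventually-× (eventually-≤∘ f h h∘f B) (eventually-map avoid (eventually-≢ (h B))))
  where
  avoid : ∀ {y} → y ≢ h B → f y ≢ B
  avoid {y} y≢hB fy≡B = y≢hB (trans (sym (h∘f y)) (cong h fy≡B))

eventually-∘ : (f h : ℕ → ℕ) → (∀ y → h (f y) ≡ y) → Eventually P → Eventually (P ∘ f)
eventually-∘ f h h∘f (B , p) = eventually-map (λ {y} → p (f y)) (eventually-≤∘ f h h∘f B)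

eventually-moved : IsCofinitary G → ∀ {g} → NonIdIn G g → Eventually (λ y → fun g y ≢ y)
eventually-moved cof {g} (g∈G , g≢id) with IsCofinitary.cofinitary cof g g∈G g≢id
... | B , fixed<B = B , λ y B≤y gy≡y → <⇒≱ (fixed<B y gy≡y) B≤y

Touched : PInj → ℕ → Set
Touched t z = Dom t z ⊎ Ran t z

Isolated : PInj → ℕ → Set
Isolated t z = ¬ Touched t z

isolated-∷ : ∀ {n m} → Isolated s z → z ≢ n → z ≢ m → Isolated ((n , m) ∷ s) z
isolated-∷ iso z≢n z≢m (inj₁ (_ , here eq)) = z≢n (cong proj₁ eq)
isolated-∷ iso z≢n z≢m (inj₁ (b , there e)) = iso (inj₁ (b , e))
isolated-∷ iso z≢n z≢m (inj₂ (_ , here eq)) = z≢m (cong proj₂ eq)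
isolated-∷ iso z≢n z≢m (inj₂ (a , there e)) = iso (inj₂ (a , e))

eventually-isolated : ∀ s → Eventually (Isolated s)
eventually-isolated [] = 0 , λ { _ _ (inj₁ (_ , ())) ; _ _ (inj₂ (_ , ())) }
eventually-isolated ((n , m) ∷ s) =
  eventually-map (λ (z≢n , z≢m , iso) → isolated-∷ iso z≢n z≢m)
    (eventually-× (eventually-≢ n) (eventually-× (eventually-≢ m) (eventually-isolated s)))

NonIdLetter : (Perm → Set) → Letter → Set
NonIdLetter G (gL g) = NonIdIn G g
NonIdLetter G xL     = ⊤
NonIdLetter G xiL    = ⊤

FarLetter : (ℕ → Set) → ℕ → Letter → Set
FarLetter P y (gL g) = P (fun g y) × P (inv g y) × fun g y ≢ y
FarLetter P y xL     = ⊤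
FarLetter P y xiL    = ⊤

FarLetter-mono : (∀ {z} → z ≢ y → P z → Q z) → FarLetter P y l → FarLetter Q y l
FarLetter-mono {y = y} {l = gL g} f (p , p′ , moved) = f moved p , f inv-moved p′ , moved
  where
  inv-moved : inv g y ≢ y
  inv-moved e = moved (trans (cong (fun g) (sym e)) (fun∘inv g y))
FarLetter-mono {l = xL}  f _ = tt
FarLetter-mono {l = xiL} f _ = tt

eventually-far : IsCofinitary G → Eventually P → NonIdLetter G l → Eventually (λ y → FarLetter P y l)
eventually-far {l = gL g} cof ev g≢id =
  eventually-× (eventually-∘ (fun g) (inv g) (inv∘fun g) ev)
    (eventually-× (eventually-∘ (inv g) (fun g) (fun∘inv g) ev) (eventually-moved cof g≢id))
eventually-far {l = xL}  cof ev _ = 0 , λ _ _ → tt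
eventually-far {l = xiL} cof ev _ = 0 , λ _ _ → tt

letterRel-∷ : ∀ {e} l → LetterRel l s a b → LetterRel l (e ∷ s) a b
letterRel-∷ (gL g) st = st
letterRel-∷ xL     st = there st
letterRel-∷ xiL    st = there st

eval-∷ : ∀ {e} w → Eval w s a b → Eval w (e ∷ s) a b
eval-∷ []      ev             = ev
eval-∷ (l ∷ w) (k , ev , st) = k , eval-∷ w ev , letterRel-∷ l st

eval-++⁺ : ∀ {V} U → Eval V s a c → Eval U s c b → Eval (U ++ V) s a b
eval-++⁺ []      ev refl           = ev
eval-++⁺ (l ∷ U) ev (k , ev′ , st) = k , eval-++⁺ U ev ev′ , st

eval-∷ʳ⁻ : ∀ V → Eval (V ∷ʳ p) s a b → ∃ λ o → LetterRel p s a o × Eval V s o b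
eval-∷ʳ⁻ []      (_ , refl , st) = _ , st , refl
eval-∷ʳ⁻ (l ∷ V) (k , ev , st) with eval-∷ʳ⁻ V ev
... | o , st′ , ev′ = o , st′ , (k , ev′ , st)

ReducedPair : Letter → Letter → Set
ReducedPair (gL _) (gL _) = ⊥
ReducedPair xL     xiL    = ⊥
ReducedPair xiL    xL     = ⊥
ReducedPair _      _      = ⊤

Reduced : Word → Set
Reduced = Linked ReducedPair

CyclicallyReduced : Word → Set
CyclicallyReduced []      = ⊥
CyclicallyReduced (l ∷ w) = Reduced ((l ∷ w) ∷ʳ l)

module _ {A : Set} {R : A → A → Set} where

  linked-++⁻ˡ : ∀ xs {ys} → Linked R (xs ++ ys) → Linked R xs
  linked-++⁻ˡ []           _         = []
  linked-++⁻ˡ (x ∷ [])     _         = [-]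
  linked-++⁻ˡ (x ∷ y ∷ xs) (r ∷ rs)  = r ∷ linked-++⁻ˡ (y ∷ xs) rs

  linked-∷ʳ⁻ : ∀ xs {x y} → Linked R (xs ∷ʳ x ∷ʳ y) → R x y
  linked-∷ʳ⁻ []           (r ∷ _)  = r
  linked-∷ʳ⁻ (_ ∷ [])     (_ ∷ rs) = linked-∷ʳ⁻ [] rs
  linked-∷ʳ⁻ (_ ∷ x ∷ xs) (_ ∷ rs) = linked-∷ʳ⁻ (x ∷ xs) rs

  linked-∷ʳ : ∀ xs {x y} → Linked R (xs ∷ʳ x) → R x y → Linked R (xs ∷ʳ x ∷ʳ y)
  linked-∷ʳ []           _        r = r ∷ [-]
  linked-∷ʳ (_ ∷ [])     (q ∷ _)  r = q ∷ r ∷ [-]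
  linked-∷ʳ (_ ∷ x ∷ xs) (q ∷ rs) r = q ∷ linked-∷ʳ (x ∷ xs) rs r

cyclicallyReduced-rotate₁ : ∀ l w → CyclicallyReduced (l ∷ w) → CyclicallyReduced (w ∷ʳ l)
cyclicallyReduced-rotate₁ l []      cyc      = cyc
cyclicallyReduced-rotate₁ l (l′ ∷ w) (r ∷ rs) = linked-∷ʳ (l′ ∷ w) rs r

cyclicallyReduced-rotate : ∀ U V → CyclicallyReduced (U ++ V) → CyclicallyReduced (V ++ U)
cyclicallyReduced-rotate [] V cyc = subst CyclicallyReduced (sym (++-identityʳ V)) cyc
cyclicallyReduced-rotate (l ∷ U) V cyc =
  subst CyclicallyReduced (++-assoc V [ l ] U)
    (cyclicallyReduced-rotate U (V ∷ʳ l)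
      (subst CyclicallyReduced (++-assoc U V [ l ]) (cyclicallyReduced-rotate₁ l (U ++ V) cyc)))

StartsWithG : Word → Set
StartsWithG (gL _ ∷ _) = ⊤
StartsWithG _          = ⊥

power-reduced : ∀ {l} j {V} → ReducedPair l l → (∀ {h} → ReducedPair l (gL h)) →
  StartsWithG V → Reduced V → Reduced (l ∷ replicate j l ++ V)
power-reduced zero    {gL _ ∷ _} _  lg _ r = lg ∷ r
power-reduced (suc j)            ll lg sv r = ll ∷ power-reduced j ll lg sv r

Block : (Perm → Set) → Word → Set
Block G u = Σ ℤ λ k → Σ Perm λ g → k ≢ + 0 × NonIdIn G g × u ≡ gL g ∷ xint k

block-reduced : ∀ {g V} k → k ≢ + 0 → StartsWithG V → Reduced V → Reduced (gL g ∷ xint k ++ V)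
block-reduced (+ zero)    k≢0 _  _ = ⊥-elim (k≢0 refl)
block-reduced (+ suc j)   _   sv r = tt ∷ power-reduced j tt tt sv r
block-reduced -[1+ j ]    _   sv r = tt ∷ power-reduced j tt tt sv r

blocks-startsWithG : ∀ {Us V} → All (Block G) Us → StartsWithG V → StartsWithG (concat Us ++ V)
blocks-startsWithG []                          sv = sv
blocks-startsWithG ((_ , _ , _ , _ , refl) ∷ _) _  = tt

blocks-reduced : ∀ {Us V} → All (Block G) Us → StartsWithG V → Reduced V → Reduced (concat Us ++ V)
blocks-reduced []                                                sv r = r
blocks-reduced {Us = _ ∷ Us} {V} ((k , g , k≢0 , _ , refl) ∷ bs) sv r =
  subst Reduced (cong (gL g ∷_) (sym (++-assoc (xint k) (concat Us) V)))
    (block-reduced k k≢0 (blocks-startsWithG bs sv) (blocks-reduced bs sv r))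

block-nonId : ∀ {u} → Block G u → All (NonIdLetter G) u
block-nonId (+ k      , _ , _ , g≢id , refl) = g≢id ∷ replicate⁺ k tt
block-nonId (-[1+ k ] , _ , _ , g≢id , refl) = g≢id ∷ replicate⁺ (suc k) tt

cyclicallyReduced-startsWithG : ∀ w → StartsWithG w → (∀ {h} → Reduced (w ∷ʳ gL h)) →
  CyclicallyReduced w
cyclicallyReduced-startsWithG (gL _ ∷ _) _ r = r

xpow-cyclicallyReduced : ∀ j → CyclicallyReduced (xpow (suc j))
xpow-cyclicallyReduced zero    = tt ∷ [-]
xpow-cyclicallyReduced (suc j) = tt ∷ xpow-cyclicallyReduced j

nice⇒nonId×cyclicallyReduced : IsNice G w → All (NonIdLetter G) w × CyclicallyReduced w
nice⇒nonId×cyclicallyReduced (inj₁ (suc j , _ , refl)) =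
  replicate⁺ (suc j) tt , xpow-cyclicallyReduced j
nice⇒nonId×cyclicallyReduced {G = G} (inj₂ (suc j , g₀ , bs , _ , g₀≢id , bs-nonId , refl)) =
  ++⁺ (concat⁺ (All.map block-nonId blocks)) (g₀≢id ∷ replicate⁺ (suc j) tt) ,
  cyclicallyReduced-startsWithG (concat Us ++ gL g₀ ∷ xpow (suc j)) (blocks-startsWithG blocks tt)
    (λ {h} → subst Reduced (sym (++-assoc (concat Us) (gL g₀ ∷ xpow (suc j)) [ gL h ]))
               (blocks-reduced blocks tt (tt ∷ power-reduced {xL} j tt tt tt [-])))
  where
  Us : List Word
  Us = reverse (map _ bs)
  blocks : All (Block G) Us
  blocks = All-resp-↭ (↭-sym (↭-reverse _))
    (map⁺ (All.map (λ (k≢0 , g≢id) → _ , _ , k≢0 , g≢id , refl) bs-nonId))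

source-touched : ∀ {g} l → ReducedPair l (gL g) → LetterRel l s a b → Touched s a
source-touched xL  _ st = inj₁ (_ , st)
source-touched xiL _ st = inj₂ (_ , st)

target-touched : ∀ {g} l → ReducedPair (gL g) l → LetterRel l s a b → Touched s b
target-touched xL  _ st = inj₂ (_ , st)
target-touched xiL _ st = inj₁ (_ , st)

module _ {t y} (not-interior : ¬ (Dom t y × Ran t y)) where

  LeavesAlong : Letter → Set
  LeavesAlong a = (Dom t y × ReducedPair xL a) ⊎ (Ran t y × ReducedPair xiL a)

  leaves-along-edge-∷ʳ : ∀ {a} V p → Reduced (V ∷ʳ p ∷ʳ a) →
    All (FarLetter (Isolated t) y) (V ∷ʳ p) → Eval (V ∷ʳ p) t y y → LeavesAlong a
  leaves-along-edge-∷ʳ V xL  red _ ev = inj₁ ((_ , proj₁ (proj₂ (eval-∷ʳ⁻ V ev))) , linked-∷ʳ⁻ V red)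
  leaves-along-edge-∷ʳ V xiL red _ ev = inj₂ ((_ , proj₁ (proj₂ (eval-∷ʳ⁻ V ev))) , linked-∷ʳ⁻ V red)
  leaves-along-edge-∷ʳ V (gL g) red far ev
    with proj₂ (∷ʳ⁻ {xs = V} far) | initLast V | eval-∷ʳ⁻ V ev
  ... | _ , _ , moved | []      | _ , refl , gy≡y = ⊥-elim (moved gy≡y)
  ... | gy-iso , _    | U ∷ʳ′ q | _ , refl , ev′ =
    ⊥-elim (gy-iso (source-touched q (linked-∷ʳ⁻ U (linked-++⁻ˡ (U ∷ʳ q ∷ʳ gL g) red))
                                   (proj₁ (proj₂ (eval-∷ʳ⁻ U ev′)))))

  leaves-along-edge : ∀ a w → Reduced ((a ∷ w) ∷ʳ a) → All (FarLetter (Isolated t) y) (a ∷ w) →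
    Eval (a ∷ w) t y y → LeavesAlong a
  leaves-along-edge a w red far ev with initLast w
  ... | []      = leaves-along-edge-∷ʳ [] a red far ev
  ... | W ∷ʳ′ p = leaves-along-edge-∷ʳ (a ∷ W) p red far ev

  -- The first letter applied leaves y and the last one enters it; as y is not interior both
  -- steps use x-letters, in opposite directions, and these are cyclically adjacent.
  no-fixed-point : ∀ w → CyclicallyReduced w → All (FarLetter (Isolated t) y) w → ¬ Eval w t y y
  no-fixed-point (gL g ∷ []) _ ((_ , _ , moved) ∷ _) (_ , refl , gy≡y) = moved gy≡y
  no-fixed-point (gL g ∷ l ∷ w) (r ∷ _) ((_ , g⁻¹y-iso , _) ∷ _) (d , (_ , _ , st) , gd≡y) =
    g⁻¹y-iso (subst (Touched t) d≡g⁻¹y (target-touched l r st))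
    where
    d≡g⁻¹y : d ≡ inv g y
    d≡g⁻¹y = trans (sym (inv∘fun g d)) (cong (inv g) gd≡y)
  no-fixed-point (xL ∷ w) red far ev@(_ , _ , into) with leaves-along-edge xL w red far ev
  ... | inj₁ (out , _) = not-interior (out , (_ , into))
  ... | inj₂ (_ , ())
  no-fixed-point (xiL ∷ w) red far ev@(_ , _ , into) with leaves-along-edge xiL w red far ev
  ... | inj₁ (_ , ())
  ... | inj₂ (out , _) = not-interior ((_ , into) , out)

Fresh : PInj → ℕ → ℕ → Set
Fresh s c z = Isolated s z × z ≢ c

eventually-fresh : IsCofinitary G → ∀ {E} → All (IsNice G) E → ∀ s c →
  Eventually (λ y → Fresh s c y × All (All (FarLetter (Fresh s c) y)) E)
eventually-fresh {G = G} cof nice s c = eventually-× fresh (eventually-All (All.map far nice))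
  where
  fresh : Eventually (Fresh s c)
  fresh = eventually-× (eventually-isolated s) (eventually-≢ c)
  far : ∀ {w} → IsNice G w → Eventually (λ y → All (FarLetter (Fresh s c) y) w)
  far nice = eventually-All
    (All.map (eventually-far cof fresh) (proj₁ (nice⇒nonId×cyclicallyReduced nice)))

isMinOf-cong : ∀ {μ} → (∀ {k} → P k → Q k) → (∀ {k} → Q k → P k) → IsMinOf P μ → IsMinOf Q μ
isMinOf-cong P⇒Q Q⇒P (pμ , min) = P⇒Q pμ , λ k qk → min k (Q⇒P qk)

card-cong : ∀ {c} → (∀ {k} → P k → Q k) → (∀ {k} → Q k → P k) → Card P c → Card Q c
card-cong P⇒Q Q⇒P (ks , unique , spans , len) =
  ks , unique , (λ k → P⇒Q ∘ proj₁ (spans k) , proj₂ (spans k) ∘ Q⇒P) , len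

module Extension (s : PInj) (n m : ℕ) where

  t : PInj
  t = (n , m) ∷ s

  pinj-∷ : IsPartialInjection s → ¬ Dom s n → ¬ Ran s m → IsPartialInjection t
  pinj-∷ inj n∉dom m∉ran _ _ _ _ (here refl) (here refl) = (λ _ → refl) , (λ _ → refl)
  pinj-∷ inj n∉dom m∉ran _ _ _ b′ (here refl) (there e) =
    (λ { refl → ⊥-elim (n∉dom (b′ , e)) }) , (λ { refl → ⊥-elim (m∉ran (_ , e)) })
  pinj-∷ inj n∉dom m∉ran _ b _ _ (there e) (here refl) =
    (λ { refl → ⊥-elim (n∉dom (b , e)) }) , (λ { refl → ⊥-elim (m∉ran (_ , e)) })
  pinj-∷ inj n∉dom m∉ran a b a′ b′ (there e) (there e′) = inj a b a′ b′ e e′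

  not-interior : Isolated s y → n ≢ m → ¬ (Dom t y × Ran t y)
  not-interior iso n≢m ((_ , here refl) , (_ , here eq)) = n≢m (cong proj₂ eq)
  not-interior iso n≢m ((_ , there e)   , _)             = iso (inj₁ (_ , e))
  not-interior iso n≢m (_               , (_ , there e)) = iso (inj₂ (_ , e))

  PassesThrough : Word → ℕ → ℕ → ℕ → Set
  PassesThrough w a b y = ∃₂ λ U V → w ≡ U ++ V × Eval V t a y × Eval U t y b

  letterRel-∷⁻ : y ≡ n ⊎ y ≡ m → ∀ l → LetterRel l t a b → LetterRel l s a b ⊎ (y ≡ a ⊎ y ≡ b)
  letterRel-∷⁻ _   (gL g) st          = inj₁ st
  letterRel-∷⁻ y∈e xL     (here refl) = inj₂ y∈e
  letterRel-∷⁻ y∈e xiL    (here refl) = inj₂ (Sum.swap y∈e)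
  letterRel-∷⁻ _   xL     (there st)  = inj₁ st
  letterRel-∷⁻ _   xiL    (there st)  = inj₁ st

  passes-through-step : ∀ {l w} → Eval w t a k → LetterRel l t k b → y ≡ k ⊎ y ≡ b →
    PassesThrough (l ∷ w) a b y
  passes-through-step {l = l} {w} ev st (inj₁ refl) = [ l ] , w , refl , ev , (_ , refl , st)
  passes-through-step {l = l} {w} ev st (inj₂ refl) = [] , l ∷ w , refl , (_ , ev , st) , refl

  eval-∷⁻ : y ≡ n ⊎ y ≡ m → ∀ w → Eval w t a b → Eval w s a b ⊎ PassesThrough w a b y
  eval-∷⁻ y∈e []      ev            = inj₁ ev
  eval-∷⁻ y∈e (l ∷ w) (k , ev , st) with eval-∷⁻ y∈e w ev | letterRel-∷⁻ y∈e l st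
  ... | inj₂ (U , V , refl , ev₁ , ev₂) | _        = inj₂ (l ∷ U , V , refl , ev₁ , (k , ev₂ , st))
  ... | inj₁ ev′                        | inj₁ st′ = inj₁ (k , ev′ , st′)
  ... | inj₁ _                          | inj₂ y∈st = inj₂ (passes-through-step ev st y∈st)

  fix-∷⁻ : y ≡ n ⊎ y ≡ m → ¬ (Dom t y × Ran t y) → CyclicallyReduced w →
    All (FarLetter (Isolated t) y) w → Fix w t a → Fix w s a
  fix-∷⁻ {w = w} y∈e not-int cyc far fix with eval-∷⁻ y∈e w fix
  ... | inj₁ fix′ = fix′
  ... | inj₂ (U , V , refl , a→y , y→a) =
    ⊥-elim (no-fixed-point not-int (V ++ U) (cyclicallyReduced-rotate U V cyc)
              (++⁺ (proj₂ (++⁻ U far)) (proj₁ (++⁻ U far))) (eval-++⁺ V y→a a→y))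

  reach-∷ : Reach s a k → Reach t a k
  reach-∷ here      = here
  reach-∷ (fwd r e) = fwd (reach-∷ r) (there e)
  reach-∷ (bwd r e) = bwd (reach-∷ r) (there e)

  reach-∷⁻ : Reach t a k → Reach s a k ⊎ (Reach s a n ⊎ Reach s a m)
  reach-∷⁻ here = inj₁ here
  reach-∷⁻ (fwd r e) with reach-∷⁻ r | e
  ... | inj₂ r′ | _         = inj₂ r′
  ... | inj₁ r′ | here refl = inj₂ (inj₁ r′)
  ... | inj₁ r′ | there e′  = inj₁ (fwd r′ e′)
  reach-∷⁻ (bwd r e) with reach-∷⁻ r | e
  ... | inj₂ r′ | _         = inj₂ r′
  ... | inj₁ r′ | here refl = inj₂ (inj₂ r′)
  ... | inj₁ r′ | there e′  = inj₁ (bwd r′ e′)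

  module Orbits {y} (n∉dom : ¬ Dom s n) (m∉ran : ¬ Ran s m) (y∈e : y ≡ n ⊎ y ≡ m)
                (not-int : ¬ (Dom t y × Ran t y)) where

    reach-y : Reach t a n → Reach t a y
    reach-y r = Sum.[ (λ { refl → r }) , (λ { refl → fwd r (here refl) }) ] y∈e

    closed-avoids-n : ClosedOrb t a → ¬ Reach t a n
    closed-avoids-n cl r = not-int (cl _ (reach-y r))

    reach-closed-s : ClosedOrb s a → Reach t a k → Reach s a k
    reach-closed-s cl r with reach-∷⁻ r
    ... | inj₁ r′        = r′
    ... | inj₂ (inj₁ rn) = ⊥-elim (n∉dom (proj₁ (cl _ rn)))
    ... | inj₂ (inj₂ rm) = ⊥-elim (m∉ran (proj₂ (cl _ rm)))

    reach-closed-t : ClosedOrb t a → Reach t a k → Reach s a k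
    reach-closed-t cl r with reach-∷⁻ r
    ... | inj₁ r′        = r′
    ... | inj₂ (inj₁ rn) = ⊥-elim (closed-avoids-n cl (reach-∷ rn))
    ... | inj₂ (inj₂ rm) = ⊥-elim (closed-avoids-n cl (bwd (reach-∷ rm) (here refl)))

    closed-∷ : ClosedOrb s a → ClosedOrb t a
    closed-∷ cl k r with cl k (reach-closed-s cl r)
    ... | (j , e) , (i , e′) = (j , there e) , (i , there e′)

    closed-∷⁻ : ClosedOrb t a → ClosedOrb s a
    closed-∷⁻ cl k r with cl k (reach-∷ r)
    ... | (_ , here refl) , _              = ⊥-elim (closed-avoids-n cl (reach-∷ r))
    ... | (_ , there _)   , (_ , here refl) = ⊥-elim (closed-avoids-n cl (bwd (reach-∷ r) (here refl)))
    ... | (j , there e)   , (i , there e′)  = (j , e) , (i , e′)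

    minOf-∷⁻ : ∀ {μ} → ClosedOrb t a → IsMinOf (Reach t a) μ → IsMinOf (Reach s a) μ
    minOf-∷⁻ cl = isMinOf-cong (reach-closed-t cl) reach-∷

    nice-∷ : IsNicePInj s → IsNicePInj t
    nice-∷ nice a μ ν cl μ-min ν-min =
      nice a μ ν (closed-∷⁻ cl) (minOf-∷⁻ cl μ-min) (isMinOf-cong (_∘ closed-∷) (_∘ closed-∷⁻) ν-min)

    codes-∷ : ∀ {r} → Codes s r → Codes t r
    codes-∷ codes a μ i c cl μ-min below size =
      codes a μ i c (closed-∷⁻ cl) (minOf-∷⁻ cl μ-min)
        (card-cong (λ (cl′ , min , <μ) → closed-∷⁻ cl′ , minOf-∷⁻ cl′ min , <μ)
                   (λ (cl′ , min , <μ) →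
                      closed-∷ cl′ , isMinOf-cong reach-∷ (reach-closed-s cl′) min , <μ)
                   below)
        (card-cong (reach-closed-t cl) reach-∷ size)

  extension : ∀ {G r E y} → InZr G r s E → ¬ Dom s n → ¬ Ran s m → y ≡ n ⊎ y ≡ m →
    Isolated s y → n ≢ m → All (All (FarLetter (Isolated t) y)) E → InZr G r t E × LeqZ t E s E
  extension {E = E} {y} (cond , nice , codes) n∉dom m∉ran y∈e y-iso n≢m far =
    (record { pinj = pinj-∷ (IsCondition.pinj cond) n∉dom m∉ran ; nice = IsCondition.nice cond }
      , nice-∷ nice , codes-∷ codes)
    , (λ _ → there) , (λ _ w∈E → w∈E)
    , λ w w∈E a → fix-∷⁻ y∈e not-int (cyclicallyReduced w∈E) (All.lookup far w∈E) , eval-∷ w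
    where
    not-int : ¬ (Dom t y × Ran t y)
    not-int = not-interior y-iso n≢m
    open Orbits n∉dom m∉ran y∈e not-int
    cyclicallyReduced : ∀ {w} → w ∈ E → CyclicallyReduced w
    cyclicallyReduced w∈E =
      proj₂ (nice⇒nonId×cyclicallyReduced (All.lookup (IsCondition.nice cond) w∈E))

lemma4p5 : (G : Perm → Set) → IsCofinitary G → (r : ℕ → Fin 2) →
    (s : PInj) → (E : List Word) → InZr G r s E →
    ((n : ℕ) → ¬ Dom s n → ∃ λ B → ∀ m → B ≤ m →
        InZr G r ((n , m) ∷ s) E × LeqZ ((n , m) ∷ s) E s E)
    × ((m : ℕ) → ¬ Ran s m → ∃ λ B → ∀ n → B ≤ n →
        InZr G r ((n , m) ∷ s) E × LeqZ ((n , m) ∷ s) E s E)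
lemma4p5 G cof r s E zr = extend-source , extend-target
  where
  nice : All (IsNice G) E
  nice = IsCondition.nice (proj₁ zr)

  far-∷ : ∀ {c y n m} → (∀ {z} → z ≢ y → Fresh s c z → Isolated ((n , m) ∷ s) z) →
    All (All (FarLetter (Fresh s c) y)) E → All (All (FarLetter (Isolated ((n , m) ∷ s)) y)) E
  far-∷ f = All.map (All.map (FarLetter-mono f))

  extend-source : (n : ℕ) → ¬ Dom s n →
    Eventually (λ m → InZr G r ((n , m) ∷ s) E × LeqZ ((n , m) ∷ s) E s E)
  extend-source n n∉dom = eventually-map
    (λ ((m-iso , m≢n) , far) →
      Extension.extension s n _ zr n∉dom (m-iso ∘ inj₂) (inj₂ refl) m-iso (≢-sym m≢n)
        (far-∷ (λ z≢m (z-iso , z≢n) → isolated-∷ z-iso z≢n z≢m) far))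
    (eventually-fresh cof nice s n)

  extend-target : (m : ℕ) → ¬ Ran s m →
    Eventually (λ n → InZr G r ((n , m) ∷ s) E × LeqZ ((n , m) ∷ s) E s E)
  extend-target m m∉ran = eventually-map
    (λ ((n-iso , n≢m) , far) →
      Extension.extension s _ m zr (n-iso ∘ inj₁) m∉ran (inj₁ refl) n-iso n≢m
        (far-∷ (λ z≢n (z-iso , z≢m) → isolated-∷ z-iso z≢n z≢m) far))
    (eventually-fresh cof nice s m)
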